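{- Let $m\ge3$ be an odd integer. A nucleus $X_m$ of order $m$ that is both skew and subtractive in $\mathbb{Z}_m$ exists if and only if $3\nmid m$.
   Context: $\mathbb{Z}_m^*=\mathbb{Z}_m\setminus\{0\}$. A nucleus of order $m$ is a set of ordered pairs $X_m=\{(u_i,v_i)\}_{i=1}^{m-1}\subset\mathbb{Z}_m^*\times\mathbb{Z}_m^*$ with $\{u_1,\dots,u_{m-1}\}=\{v_1,\dots,v_{m-1}\}=\mathbb{Z}_m^*$. It is subtractive in $\mathbb{Z}_m$ if $\{(u_i-v_i)\bmod m\}_{i=1}^{m-1}=\mathbb{Z}_m^*$, and skew in $\mathbb{Z}_m$ if $\{(u_i+v_i)\bmod m\}_{i=1}^{m-1}=\mathbb{Z}_m^*$. -}

module Defs where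

open import Data.Nat using (ℕ; zero; suc; _∸_; _+_)
open import Data.Fin using (Fin; zero; suc)
open import Data.Fin using () renaming (_+_ to _+ᶠ_)
open import Data.Nat.DivMod using (_%_)
open import Data.Nat.Properties using ()
open import Data.Fin using (toℕ; fromℕ<)
open import Data.Nat.DivMod using (m%n<n)
open import Data.Product using (Σ; _×_; ∃; ∃-syntax)
open import Relation.Binary.PropositionalEquality using (_≡_)
open import Relation.Nullary using (¬_)

-- ℤ_m represented by Fin m, with m = suc n so that 0 ∈ ℤ_m exists.

addMod : ∀ {n} → Fin (suc n) → Fin (suc n) → Fin (suc n)
addMod {n} a b = fromℕ< (m%n<n (toℕ a + toℕ b) (suc n))

subMod : ∀ {n} → Fin (suc n) → Fin (suc n) → Fin (suc n)
subMod {n} a b = fromℕ< (m%n<n (toℕ a + (suc n ∸ toℕ b)) (suc n))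

ImageIsUnits : ∀ {n k} → (Fin k → Fin (suc n)) → Set
ImageIsUnits {n} {k} f =
  (∀ i → ¬ (f i ≡ zero)) × (∀ (x : Fin (suc n)) → ¬ (x ≡ zero) → ∃[ i ] f i ≡ x)

-- A nucleus of order m = suc n: pairs (u_i, v_i), i = 1..m-1 (indexed by Fin n),
-- with {u_i} = {v_i} = ℤ_m^*.
record Nucleus (n : ℕ) : Set where
  field
    u : Fin n → Fin (suc n)
    v : Fin n → Fin (suc n)
    u-units : ImageIsUnits u
    v-units : ImageIsUnits v

Subtractive : ∀ {n} → Nucleus n → Set
Subtractive X = ImageIsUnits (λ i → subMod (Nucleus.u X i) (Nucleus.v X i))

Skew : ∀ {n} → Nucleus n → Set
Skew X = ImageIsUnits (λ i → addMod (Nucleus.u X i) (Nucleus.v X i))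

-- Necessity: (u + v)² + (u − v)² ≡ 2u² + 2v² (mod m). Summed over a skew subtractive
-- nucleus, each of u, v, u + v, u − v runs exactly once through ℤ_m^*, so with
-- Q = 1² + ⋯ + (m − 1)² we get 2Q ≡ 4Q, i.e. m ∣ 2Q. Since 6Q = (m − 1)m(2m − 1), this
-- forces 3 ∣ (m − 1)(2m − 1), which fails when 3 ∣ m.
-- Sufficiency: if gcd(m, 6) = 1, take (u_i, v_i) = (2i, i). Then u_i + v_i = 3i and
-- u_i − v_i = i, and multiplication by a unit of ℤ_m permutes ℤ_m^*.

module Submission where

open import Defs
open import Data.Nat using (ℕ; suc; _≤_; _%_)
open import Data.Nat.Divisibility using (_∣_)
open import Data.Product using (∃-syntax; _×_)
open import Relation.Binary.PropositionalEquality using (_≡_)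
open import Relation.Nullary using (¬_)

open import Data.Nat.Properties
  using ( +-0-commutativeMonoid; +-*-semiring; +-comm; +-assoc; +-identityʳ; *-comm; *-assoc
        ; *-identityˡ; *-zeroʳ; *-distribˡ-+; 1+n≰n; m+[n∸m]≡n; <⇒≤ )
open import Algebra.Properties.CommutativeMonoid.Sum +-0-commutativeMonoid
  using (sum; sum-syntax; sum-cong-≗; sum-init-last; sum-permute; ∑-distrib-+)
open import Algebra.Properties.Semiring.Sum +-*-semiring using (*-distribˡ-sum)
open import Data.Fin using (Fin; zero; suc; toℕ; fromℕ; fromℕ<; inject₁; punchOut; _≟_)
open import Data.Fin.Permutation using (Permutation′; permutation)
open import Data.Fin.Properties
  using ( toℕ-fromℕ; toℕ-fromℕ<; toℕ-inject₁; toℕ-injective; toℕ<n; any?; injective⇒≤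
        ; punchOut-injective; punchOut-cong; punchIn-punchOut )
open import Data.Nat using (zero; _+_; _*_; _∸_; NonZero)
open import Data.Nat.Coprimality using (Coprime; coprime-Bézout)
open import Data.Nat.DivMod
  using ( m%n<n; m<n⇒m%n≡m; m%n%n≡m%n; [m+n]%n≡m%n; [m+kn]%n≡m%n; %-distribˡ-+; %-distribˡ-* )
open import Data.Nat.Divisibility
  using (m%n≡0⇒n∣m; n∣m⇒m%n≡0; ∣m+n∣m⇒∣n; ∣1⇒≡1; *-monoʳ-∣; *-cancelʳ-∣; module ∣-Reasoning)
open import Data.Nat.GCD using (module Bézout)
open import Data.Nat.Primality using (Prime; prime?; euclidsLemma; prime⇒irreducible)
open import Data.Nat.Tactic.RingSolver using (solve-∀)
open import Data.Product using (_,_; proj₁; proj₂)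
open import Data.Sum using (inj₁; inj₂; [_,_]′)
open import Data.Unit using (tt)
open import Function using (_∘_)
open import Relation.Binary.PropositionalEquality
  using (_≢_; refl; sym; trans; cong; cong₂; subst; module ≡-Reasoning)
open import Relation.Nullary using (yes; no; contradiction)
open import Relation.Nullary.Decidable using (toWitness)

injective⇒surjective : ∀ {n} (g : Fin n → Fin n) →
  (∀ {x y} → g x ≡ g y → x ≡ y) → ∀ y → ∃[ x ] g x ≡ y
injective⇒surjective {suc k} g g-inj y with any? (λ x → g x ≟ y)
... | yes found = found
... | no missed = contradiction (injective⇒≤ avoid-y-injective) 1+n≰n
  where
  g≢y : ∀ x → y ≢ g x
  g≢y x y≡gx = missed (x , sym y≡gx)
  avoid-y : Fin (suc k) → Fin k
  avoid-y x = punchOut (g≢y x)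
  avoid-y-injective : ∀ {x x′} → avoid-y x ≡ avoid-y x′ → x ≡ x′
  avoid-y-injective = g-inj ∘ punchOut-injective (g≢y _) (g≢y _)

surjective⇒permutation : ∀ {n} (f : Fin n → Fin n) → (∀ y → ∃[ x ] f x ≡ y) → Permutation′ n
surjective⇒permutation {n} f f-surj = permutation f section f∘section≗id section∘f≗id
  where
  section : Fin n → Fin n
  section y = proj₁ (f-surj y)
  f∘section≗id : ∀ y → f (section y) ≡ y
  f∘section≗id y = proj₂ (f-surj y)
  section-injective : ∀ {y y′} → section y ≡ section y′ → y ≡ y′
  section-injective {y} {y′} eq = trans (sym (f∘section≗id y)) (trans (cong f eq) (f∘section≗id y′))
  section∘f≗id : ∀ x → section (f x) ≡ x
  section∘f≗id x with injective⇒surjective section section-injective x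
  ... | y , refl = cong section (f∘section≗id y)

sum-over-units : ∀ {n} (f : Fin n → Fin (suc n)) → ImageIsUnits f → (H : Fin (suc n) → ℕ) →
  ∑[ i < n ] H (f i) ≡ ∑[ i < n ] H (suc i)
sum-over-units {n} f (f≢0 , f-onto) H = begin
  ∑[ i < n ] H (f i)         ≡⟨ sum-cong-≗ (λ i → cong H (sym (punchIn-punchOut (0≢f i)))) ⟩
  ∑[ i < n ] H (suc (f′ i))  ≡⟨ sum-permute (H ∘ suc) (surjective⇒permutation f′ f′-surjective) ⟨
  ∑[ i < n ] H (suc i)       ∎
  where
  open ≡-Reasoning
  0≢f : ∀ i → zero ≢ f i
  0≢f i = f≢0 i ∘ sym
  f′ : Fin n → Fin n
  f′ i = punchOut (0≢f i)
  f′-surjective : ∀ j → ∃[ i ] f′ i ≡ j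
  f′-surjective j with f-onto (suc j) (λ ())
  ... | i , fi≡1+j = i , punchOut-cong zero {i≢k = λ ()} fi≡1+j

m+kn≡o+ln⇒m%n≡o%n : ∀ m k o l {n} .{{_ : NonZero n}} → m + k * n ≡ o + l * n → m % n ≡ o % n
m+kn≡o+ln⇒m%n≡o%n m k o l {n} eq = begin
  m % n            ≡⟨ [m+kn]%n≡m%n m k n ⟨
  (m + k * n) % n  ≡⟨ cong (_% n) eq ⟩
  (o + l * n) % n  ≡⟨ [m+kn]%n≡m%n o l n ⟩
  o % n            ∎
  where open ≡-Reasoning

[m%d+n]%d≡[m+n]%d : ∀ m n d .{{_ : NonZero d}} → (m % d + n) % d ≡ (m + n) % d
[m%d+n]%d≡[m+n]%d m n d = begin
  (m % d + n) % d          ≡⟨ %-distribˡ-+ (m % d) n d ⟩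
  (m % d % d + n % d) % d  ≡⟨ cong (λ r → (r + n % d) % d) (m%n%n≡m%n m d) ⟩
  (m % d + n % d) % d      ≡⟨ %-distribˡ-+ m n d ⟨
  (m + n) % d              ∎
  where open ≡-Reasoning

[m*[n%d]]%d≡[m*n]%d : ∀ m n d .{{_ : NonZero d}} → (m * (n % d)) % d ≡ (m * n) % d
[m*[n%d]]%d≡[m*n]%d m n d = begin
  (m * (n % d)) % d          ≡⟨ %-distribˡ-* m (n % d) d ⟩
  (m % d * (n % d % d)) % d  ≡⟨ cong (λ r → (m % d * r) % d) (m%n%n≡m%n n d) ⟩
  (m % d * (n % d)) % d      ≡⟨ %-distribˡ-* m n d ⟨
  (m * n) % d                ∎
  where open ≡-Reasoning

%-cancelˡ-+ : ∀ m n o {d} .{{_ : NonZero d}} → (m + n) % d ≡ (m + o) % d → n % d ≡ o % d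
%-cancelˡ-+ m n o {d@(suc d-1)} eq = begin
  n % d                         ≡⟨ [m+kn]%n≡m%n n m d ⟨
  (n + m * d) % d               ≡⟨ shift n ⟩
  ((m + n) % d + m * d-1) % d   ≡⟨ cong (λ r → (r + m * d-1) % d) eq ⟩
  ((m + o) % d + m * d-1) % d   ≡⟨ shift o ⟨
  (o + m * d) % d               ≡⟨ [m+kn]%n≡m%n o m d ⟩
  o % d                         ∎
  where
  open ≡-Reasoning
  shift : ∀ x → (x + m * d) % d ≡ ((m + x) % d + m * d-1) % d
  shift x = trans (cong (_% d) (regroup m x d-1)) (sym ([m%d+n]%d≡[m+n]%d (m + x) (m * d-1) d))
    where
    regroup : ∀ m x d-1 → x + m * suc d-1 ≡ m + x + m * d-1
    regroup = solve-∀

sum-%-cong : ∀ {k} (f g : Fin k → ℕ) {d} .{{_ : NonZero d}} →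
  (∀ i → f i % d ≡ g i % d) → sum f % d ≡ sum g % d
sum-%-cong {zero} f g f≡g = refl
sum-%-cong {suc k} f g {d} f≡g = begin
  (f zero + sum (f ∘ suc)) % d              ≡⟨ %-distribˡ-+ (f zero) _ d ⟩
  (f zero % d + sum (f ∘ suc) % d) % d      ≡⟨ cong₂ (λ r s → (r + s) % d) (f≡g zero) (sum-%-cong _ _ (f≡g ∘ suc)) ⟩
  (g zero % d + sum (g ∘ suc) % d) % d      ≡⟨ %-distribˡ-+ (g zero) _ d ⟨
  (g zero + sum (g ∘ suc)) % d              ∎
  where open ≡-Reasoning

square : ℕ → ℕ
square x = x * x

[m%d]²+[n%d]²≡m²+n² : ∀ m n d .{{_ : NonZero d}} →
  (square (m % d) + square (n % d)) % d ≡ (square m + square n) % d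
[m%d]²+[n%d]²≡m²+n² m n d = begin
  (square (m % d) + square (n % d)) % d          ≡⟨ %-distribˡ-+ (square (m % d)) _ d ⟩
  (square (m % d) % d + square (n % d) % d) % d  ≡⟨ cong₂ (λ r s → (r + s) % d) (%-distribˡ-* m m d) (%-distribˡ-* n n d) ⟨
  (square m % d + square n % d) % d              ≡⟨ %-distribˡ-+ (square m) _ d ⟨
  (square m + square n) % d                      ∎
  where open ≡-Reasoning

toℕ-addMod : ∀ {n} (a b : Fin (suc n)) → toℕ (addMod a b) ≡ (toℕ a + toℕ b) % suc n
toℕ-addMod a b = toℕ-fromℕ< _

toℕ-subMod : ∀ {n} (a b : Fin (suc n)) → toℕ (subMod a b) ≡ (toℕ a + (suc n ∸ toℕ b)) % suc n
toℕ-subMod a b = toℕ-fromℕ< _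

parallelogram-mod : ∀ {n} (a b : Fin (suc n)) →
  (square (toℕ (addMod a b)) + square (toℕ (subMod a b))) % suc n ≡
  (2 * square (toℕ a) + 2 * square (toℕ b)) % suc n
parallelogram-mod {n} a b = begin
  (square (toℕ (addMod a b)) + square (toℕ (subMod a b))) % m
    ≡⟨ cong₂ (λ s t → (square s + square t) % m) (toℕ-addMod a b) (toℕ-subMod a b) ⟩
  (square ((x + y) % m) + square ((x + y′) % m)) % m
    ≡⟨ [m%d]²+[n%d]²≡m²+n² (x + y) (x + y′) m ⟩
  (square (x + y) + square (x + y′)) % m
    ≡⟨ m+kn≡o+ln⇒m%n≡o%n _ y _ (2 * x + y′) shifted ⟩
  (2 * square x + 2 * square y) % m
    ∎
  where
  open ≡-Reasoning
  m x y y′ : ℕ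
  m = suc n
  x = toℕ a
  y = toℕ b
  y′ = m ∸ y
  y≤m : y ≤ m
  y≤m = <⇒≤ (toℕ<n b)
  -- y′ = m − y stands for −y: this is the parallelogram law with the multiples of m
  -- moved to the side where they are added.
  parallelogram-law : ∀ x y y′ → (x + y) * (x + y) + (x + y′) * (x + y′) + y * (y + y′) ≡
                        2 * (x * x) + 2 * (y * y) + (2 * x + y′) * (y + y′)
  parallelogram-law = solve-∀
  shifted : square (x + y) + square (x + y′) + y * m ≡ 2 * square x + 2 * square y + (2 * x + y′) * m
  shifted = subst (λ k → square (x + y) + square (x + y′) + y * k ≡ 2 * square x + 2 * square y + (2 * x + y′) * k)
                  (m+[n∸m]≡n y≤m) (parallelogram-law x y y′)

sum-of-squares : ℕ → ℕ
sum-of-squares n = ∑[ i < n ] square (suc (toℕ i))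

6*sum-of-squares : ∀ n → 6 * sum-of-squares n ≡ n * suc n * (n + suc n)
6*sum-of-squares zero = refl
6*sum-of-squares (suc n) = begin
  6 * ∑[ i < suc n ] square (suc (toℕ i))
    ≡⟨ cong (6 *_) (sum-init-last {n} (λ i → square (suc (toℕ i)))) ⟩
  6 * ((∑[ i < n ] square (suc (toℕ (inject₁ i)))) + square (suc (toℕ (fromℕ n))))
    ≡⟨ cong₂ (λ s l → 6 * (s + square (suc l))) init-squares (toℕ-fromℕ n) ⟩
  6 * ((∑[ i < n ] square (suc (toℕ i))) + square (suc n))
    ≡⟨ *-distribˡ-+ 6 (∑[ i < n ] square (suc (toℕ i))) (square (suc n)) ⟩
  6 * (∑[ i < n ] square (suc (toℕ i))) + 6 * square (suc n)
    ≡⟨ cong (_+ 6 * square (suc n)) (6*sum-of-squares n) ⟩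
  n * suc n * (n + suc n) + 6 * square (suc n)
    ≡⟨ step n ⟩
  suc n * suc (suc n) * (suc n + suc (suc n))
    ∎
  where
  open ≡-Reasoning
  init-squares : ∑[ i < n ] square (suc (toℕ (inject₁ i))) ≡ ∑[ i < n ] square (suc (toℕ i))
  init-squares = sum-cong-≗ {n} (λ i → cong (square ∘ suc) (toℕ-inject₁ i))
  step : ∀ n → n * suc n * (n + suc n) + 6 * (suc n * suc n) ≡ suc n * suc (suc n) * (suc n + suc (suc n))
  step = solve-∀

skew∧subtractive⇒∣2*sum-of-squares : ∀ {n} (X : Nucleus n) → Skew X → Subtractive X →
  suc n ∣ 2 * sum-of-squares n
skew∧subtractive⇒∣2*sum-of-squares {n} X skew subtractive = m%n≡0⇒n∣m (2 * Q) m (sym (%-cancelˡ-+ (2 * Q) 0 (2 * Q) 2Q≡4Q))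
  where
  open Nucleus X
  open ≡-Reasoning
  m : ℕ
  m = suc n
  sq : Fin m → ℕ
  sq x = square (toℕ x)
  Q : ℕ
  Q = sum-of-squares n
  twice-units : ∀ (f : Fin n → Fin m) → ImageIsUnits f → ∑[ i < n ] (2 * sq (f i)) ≡ 2 * Q
  twice-units f f-units = begin
    ∑[ i < n ] (2 * sq (f i))  ≡⟨ *-distribˡ-sum 2 (sq ∘ f) ⟨
    2 * ∑[ i < n ] sq (f i)    ≡⟨ cong (2 *_) (sum-over-units f f-units sq) ⟩
    2 * Q                      ∎
  2Q≡4Q : (2 * Q + 0) % m ≡ (2 * Q + 2 * Q) % m
  2Q≡4Q = begin
    (2 * Q + 0) % m
      ≡⟨ cong (_% m) (trans (+-identityʳ (2 * Q)) (cong (Q +_) (+-identityʳ Q))) ⟩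
    (Q + Q) % m
      ≡⟨ cong (_% m) (cong₂ _+_ (sum-over-units _ skew sq) (sum-over-units _ subtractive sq)) ⟨
    (∑[ i < n ] sq (addMod (u i) (v i)) + ∑[ i < n ] sq (subMod (u i) (v i))) % m
      ≡⟨ cong (_% m) (∑-distrib-+ (sq ∘ λ i → addMod (u i) (v i)) (sq ∘ λ i → subMod (u i) (v i))) ⟨
    (∑[ i < n ] (sq (addMod (u i) (v i)) + sq (subMod (u i) (v i)))) % m
      ≡⟨ sum-%-cong _ _ (λ i → parallelogram-mod (u i) (v i)) ⟩
    (∑[ i < n ] (2 * sq (u i) + 2 * sq (v i))) % m
      ≡⟨ cong (_% m) (∑-distrib-+ (λ i → 2 * sq (u i)) (λ i → 2 * sq (v i))) ⟩
    (∑[ i < n ] (2 * sq (u i)) + ∑[ i < n ] (2 * sq (v i))) % m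
      ≡⟨ cong (_% m) (cong₂ _+_ (twice-units u u-units) (twice-units v v-units)) ⟩
    (2 * Q + 2 * Q) % m
      ∎

2-prime : Prime 2
2-prime = toWitness {a? = prime? 2} tt

3-prime : Prime 3
3-prime = toWitness {a? = prime? 3} tt

∣n∧∣1+n⇒≡1 : ∀ {d} n → d ∣ n → d ∣ suc n → d ≡ 1
∣n∧∣1+n⇒≡1 {d} n d∣n d∣1+n = ∣1⇒≡1 (∣m+n∣m⇒∣n (subst (d ∣_) (+-comm 1 n) d∣1+n) d∣n)

3∤n[n+1+n] : ∀ n → 3 ∣ suc n → ¬ 3 ∣ n * (n + suc n)
3∤n[n+1+n] n 3∣1+n = [ 3∤n , 3∤n ∘ 3∣n+[1+n]⇒3∣n ]′ ∘ euclidsLemma n (n + suc n) 3-prime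
  where
  3∤n : ¬ 3 ∣ n
  3∤n 3∣n with ∣n∧∣1+n⇒≡1 n 3∣n 3∣1+n
  ... | ()
  3∣n+[1+n]⇒3∣n : 3 ∣ n + suc n → 3 ∣ n
  3∣n+[1+n]⇒3∣n 3∣n+[1+n] = ∣m+n∣m⇒∣n (subst (3 ∣_) (+-comm n (suc n)) 3∣n+[1+n]) 3∣1+n

skew∧subtractive⇒3∤ : ∀ {n} (X : Nucleus n) → Skew X → Subtractive X → ¬ 3 ∣ suc n
skew∧subtractive⇒3∤ {n} X skew subtractive 3∣m = 3∤n[n+1+n] n 3∣m (*-cancelʳ-∣ m 3m∣n[n+m]m)
  where
  open ∣-Reasoning
  m : ℕ
  m = suc n
  Q : ℕ
  Q = sum-of-squares n
  3m∣n[n+m]m : 3 * m ∣ n * (n + m) * m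
  3m∣n[n+m]m = begin
    3 * m            ∣⟨ *-monoʳ-∣ 3 (skew∧subtractive⇒∣2*sum-of-squares X skew subtractive) ⟩
    3 * (2 * Q)      ≡⟨ sym (*-assoc 3 2 Q) ⟩
    6 * Q            ≡⟨ 6*sum-of-squares n ⟩
    n * m * (n + m)  ≡⟨ regroup n m ⟩
    n * (n + m) * m  ∎
    where
    regroup : ∀ n m → n * m * (n + m) ≡ n * (n + m) * m
    regroup = solve-∀

scale : ∀ {n} → ℕ → Fin (suc n) → Fin (suc n)
scale {n} c x = fromℕ< (m%n<n (c * toℕ x) (suc n))

toℕ-scale : ∀ {n} c (x : Fin (suc n)) → toℕ (scale c x) ≡ (c * toℕ x) % suc n
toℕ-scale c x = toℕ-fromℕ< _

scale-1 : ∀ {n} (x : Fin (suc n)) → scale 1 x ≡ x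
scale-1 {n} x = toℕ-injective (trans (toℕ-scale 1 x)
  (trans (cong (_% suc n) (*-identityˡ (toℕ x))) (m<n⇒m%n≡m (toℕ<n x))))

scale-zero : ∀ {n} c → scale {n} c zero ≡ zero
scale-zero {n} c = toℕ-injective (trans (toℕ-scale c zero) (cong (_% suc n) (*-zeroʳ c)))

scale-suc : ∀ {n} c (x : Fin (suc n)) → addMod (scale c x) x ≡ scale (suc c) x
scale-suc {n} c x = toℕ-injective (begin
  toℕ (addMod (scale c x) x)     ≡⟨ toℕ-addMod (scale c x) x ⟩
  (toℕ (scale c x) + toℕ x) % m  ≡⟨ cong (λ r → (r + toℕ x) % m) (toℕ-scale c x) ⟩
  ((c * toℕ x) % m + toℕ x) % m  ≡⟨ [m%d+n]%d≡[m+n]%d (c * toℕ x) (toℕ x) m ⟩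
  (c * toℕ x + toℕ x) % m        ≡⟨ cong (_% m) (+-comm (c * toℕ x) (toℕ x)) ⟩
  (suc c * toℕ x) % m            ≡⟨ toℕ-scale (suc c) x ⟨
  toℕ (scale (suc c) x)          ∎)
  where
  open ≡-Reasoning
  m : ℕ
  m = suc n

scale-inverse : ∀ {n} c h → (c * h) % suc n ≡ 1 % suc n → ∀ x → scale c (scale h x) ≡ x
scale-inverse {n} c h ch≡1 x = toℕ-injective (begin
  toℕ (scale c (scale h x))          ≡⟨ toℕ-scale c (scale h x) ⟩
  (c * toℕ (scale h x)) % m          ≡⟨ cong (λ r → (c * r) % m) (toℕ-scale h x) ⟩
  (c * ((h * toℕ x) % m)) % m        ≡⟨ [m*[n%d]]%d≡[m*n]%d c (h * toℕ x) m ⟩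
  (c * (h * toℕ x)) % m              ≡⟨ cong (_% m) (*-assoc c h (toℕ x)) ⟨
  (c * h * toℕ x) % m                ≡⟨ %-distribˡ-* (c * h) (toℕ x) m ⟩
  ((c * h) % m * (toℕ x % m)) % m    ≡⟨ cong (λ r → (r * (toℕ x % m)) % m) ch≡1 ⟩
  (1 % m * (toℕ x % m)) % m          ≡⟨ %-distribˡ-* 1 (toℕ x) m ⟨
  (1 * toℕ x) % m                    ≡⟨ toℕ-scale 1 x ⟨
  toℕ (scale 1 x)                    ≡⟨ cong toℕ (scale-1 x) ⟩
  toℕ x                              ∎)
  where
  open ≡-Reasoning
  m : ℕ
  m = suc n

subMod-addMod : ∀ {n} (a b : Fin (suc n)) → subMod (addMod a b) b ≡ a
subMod-addMod {n} a b = toℕ-injective (begin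
  toℕ (subMod (addMod a b) b)               ≡⟨ toℕ-subMod (addMod a b) b ⟩
  (toℕ (addMod a b) + (m ∸ toℕ b)) % m      ≡⟨ cong (λ r → (r + (m ∸ toℕ b)) % m) (toℕ-addMod a b) ⟩
  ((toℕ a + toℕ b) % m + (m ∸ toℕ b)) % m   ≡⟨ [m%d+n]%d≡[m+n]%d (toℕ a + toℕ b) (m ∸ toℕ b) m ⟩
  (toℕ a + toℕ b + (m ∸ toℕ b)) % m         ≡⟨ cong (_% m) (+-assoc (toℕ a) (toℕ b) (m ∸ toℕ b)) ⟩
  (toℕ a + (toℕ b + (m ∸ toℕ b))) % m       ≡⟨ cong (λ r → (toℕ a + r) % m) (m+[n∸m]≡n (<⇒≤ (toℕ<n b))) ⟩
  (toℕ a + m) % m                           ≡⟨ [m+n]%n≡m%n (toℕ a) m ⟩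
  toℕ a % m                                 ≡⟨ m<n⇒m%n≡m (toℕ<n a) ⟩
  toℕ a                                     ∎)
  where
  open ≡-Reasoning
  m : ℕ
  m = suc n

suc-units : ∀ {n} → ImageIsUnits {n} suc
suc-units = (λ i ()) , onto
  where
  onto : ∀ y → y ≢ zero → ∃[ i ] suc i ≡ y
  onto zero    0≢0 = contradiction refl 0≢0
  onto (suc j) _   = j , refl

units-cong : ∀ {n k} {f g : Fin k → Fin (suc n)} → (∀ i → f i ≡ g i) → ImageIsUnits f → ImageIsUnits g
units-cong {f = f} {g} f≗g (f≢0 , f-onto) = g≢0 , g-onto
  where
  g≢0 : ∀ i → g i ≢ zero
  g≢0 i = f≢0 i ∘ trans (f≗g i)
  g-onto : ∀ y → y ≢ zero → ∃[ i ] g i ≡ y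
  g-onto y y≢0 with f-onto y y≢0
  ... | i , fi≡y = i , trans (sym (f≗g i)) fi≡y

scale-units : ∀ {n} c h → (c * h) % suc n ≡ 1 % suc n → ImageIsUnits (λ (i : Fin n) → scale c (suc i))
scale-units {n} c h ch≡1 = nonzero , onto
  where
  unscale : ∀ x → scale h (scale c x) ≡ x
  unscale = scale-inverse h c (trans (cong (_% suc n) (*-comm h c)) ch≡1)
  rescale : ∀ y → scale c (scale h y) ≡ y
  rescale = scale-inverse c h ch≡1
  nonzero : ∀ i → scale c (suc i) ≢ zero
  nonzero i c[1+i]≡0 with trans (sym (unscale (suc i))) (trans (cong (scale h) c[1+i]≡0) (scale-zero h))
  ... | ()
  onto : ∀ y → y ≢ zero → ∃[ i ] scale c (suc i) ≡ y
  onto y y≢0 = punchOut 0≢h[y] , trans (cong (scale c) (punchIn-punchOut 0≢h[y])) (rescale y)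
    where
    0≢h[y] : zero ≢ scale h y
    0≢h[y] 0≡h[y] = y≢0 (trans (sym (rescale y)) (trans (cong (scale c) (sym 0≡h[y])) (scale-zero c)))

prime∤⇒coprime : ∀ {p m} → Prime p → ¬ p ∣ m → Coprime p m
prime∤⇒coprime p-prime p∤m (d∣p , d∣m) with prime⇒irreducible p-prime d∣p
... | inj₁ d≡1  = d≡1
... | inj₂ refl = contradiction d∣m p∤m

coprime⇒invertible : ∀ {c m} .{{_ : NonZero m}} → Coprime c m → ∃[ h ] (c * h) % m ≡ 1 % m
-- Bézout gives x c ≡ ±1 (mod m); in the − case multiply by k ≡ −1.
coprime⇒invertible {c} {m@(suc k)} c⊥m with coprime-Bézout c⊥m
... | Bézout.+- x y 1+ym≡xc =
  x , m+kn≡o+ln⇒m%n≡o%n (c * x) 0 1 y (trans (+-identityʳ (c * x)) (trans (*-comm c x) (sym 1+ym≡xc)))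
... | Bézout.-+ x y 1+xc≡ym = k * x , m+kn≡o+ln⇒m%n≡o%n (c * (k * x)) 1 1 (k * y) (begin
  c * (k * x) + 1 * m  ≡⟨ expand c k x ⟩
  k * (1 + x * c) + 1  ≡⟨ cong (λ r → k * r + 1) 1+xc≡ym ⟩
  k * (y * m) + 1      ≡⟨ collect k y ⟩
  1 + k * y * m        ∎)
  where
  open ≡-Reasoning
  expand : ∀ c k x → c * (k * x) + 1 * suc k ≡ k * (1 + x * c) + 1
  expand = solve-∀
  collect : ∀ k y → k * (y * suc k) + 1 ≡ 1 + k * y * suc k
  collect = solve-∀

doubling-nucleus : ∀ {n} h → (2 * h) % suc n ≡ 1 % suc n → Nucleus n
doubling-nucleus h 2h≡1 = record
  { u = λ i → scale 2 (suc i)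
  ; v = suc
  ; u-units = scale-units 2 h 2h≡1
  ; v-units = suc-units
  }

doubling-nucleus-skew : ∀ {n} h (2h≡1 : (2 * h) % suc n ≡ 1 % suc n) h′ → (3 * h′) % suc n ≡ 1 % suc n →
  Skew (doubling-nucleus h 2h≡1)
doubling-nucleus-skew h 2h≡1 h′ 3h′≡1 = units-cong (λ i → sym (scale-suc 2 (suc i))) (scale-units 3 h′ 3h′≡1)

doubling-nucleus-subtractive : ∀ {n} h (2h≡1 : (2 * h) % suc n ≡ 1 % suc n) → Subtractive (doubling-nucleus h 2h≡1)
doubling-nucleus-subtractive h 2h≡1 = units-cong (λ i → sym (2x-x≡x (suc i))) suc-units
  where
  2x-x≡x : ∀ {n} (x : Fin (suc n)) → subMod (scale 2 x) x ≡ x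
  2x-x≡x x = begin
    subMod (scale 2 x) x              ≡⟨ cong (λ y → subMod y x) (scale-suc 1 x) ⟨
    subMod (addMod (scale 1 x) x) x   ≡⟨ cong (λ y → subMod (addMod y x) x) (scale-1 x) ⟩
    subMod (addMod x x) x             ≡⟨ subMod-addMod x x ⟩
    x                                 ∎
    where open ≡-Reasoning

coprime-6⇒skew-subtractive : ∀ {n} → Coprime 2 (suc n) → Coprime 3 (suc n) → ∃[ X ] (Skew {n} X × Subtractive {n} X)
coprime-6⇒skew-subtractive 2⊥m 3⊥m with coprime⇒invertible 2⊥m | coprime⇒invertible 3⊥m
... | h , 2h≡1 | h′ , 3h′≡1 =
  doubling-nucleus h 2h≡1 , doubling-nucleus-skew h 2h≡1 h′ 3h′≡1 , doubling-nucleus-subtractive h 2h≡1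

lemma3p21 : (n : ℕ) → 3 ≤ suc n → suc n % 2 ≡ 1 →
    ((∃[ X ] (Skew {n} X × Subtractive {n} X)) → ¬ (3 ∣ suc n)) ×
    (¬ (3 ∣ suc n) → ∃[ X ] (Skew {n} X × Subtractive {n} X))
lemma3p21 n _ m-odd =
  (λ (X , skew , subtractive) → skew∧subtractive⇒3∤ X skew subtractive) ,
  (λ 3∤m → coprime-6⇒skew-subtractive (prime∤⇒coprime 2-prime 2∤m) (prime∤⇒coprime 3-prime 3∤m))
  where
  2∤m : ¬ 2 ∣ suc n
  2∤m 2∣m with trans (sym m-odd) (n∣m⇒m%n≡0 (suc n) 2 2∣m)
  ... | ()
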